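{- Let $i,j$ be integers with $1\leq i\leq n$ and $0\leq j<i$. Let $X_i^j$ be a subset of $\{\pm1,\pm2,\dots,\pm(i-1),i,\pm(i+1),\dots,\pm n\}$ such that for every $1\leq r\leq n$ exactly one of $r$ and $-r$ belongs to $X_i^j$, and exactly $j$ negative numbers from $\{\pm1,\dots,\pm(i-1)\}$ belong to $X_i^j$. Let $\mathfrak{T}_{n,X_i^j}$ be the set of permutations $\pi_1\cdots\pi_n$ of $X_i^j$ with $\pi_n=i$. Then \[ \sum_{\pi\in\mathfrak{T}_{n,X_i^j}}t^{\mathrm{des}_B(\pi)}=\mathbf{A}_{n,i-j}(t). \]
   Context: For a permutation $\pi$ of $[n]$, $\mathrm{des}(\pi)=|\{k\in[n-1]:\pi_k>\pi_{k+1}\}|$; $\mathfrak{S}_{n,m}$ is the set of permutations of $[n]$ ending with $m$, and $\mathbf{A}_{n,m}(t)=\sum_{\pi\in\mathfrak{S}_{n,m}}t^{\mathrm{des}(\pi)}$. For a signed permutation $\sigma=\sigma_1\cdots\sigma_n$ of $[n]$, with $\sigma_0=0$, $\mathrm{des}_B(\sigma)=|\{k\in\{0,\dots,n-1\}:\sigma_k>\sigma_{k+1}\}|$. For a set $Y$ of nonzero integers with distinct absolute values, the reduction $\mathrm{red}$ replaces the entry with the $k$-th smallest absolute value by $k$ or $-k$ according to its sign; for a permutation $\pi$ of $Y$, $\mathrm{red}(\pi)$ is obtained entrywise, and $\mathrm{des}_B(\pi):=\mathrm{des}_B(\mathrm{red}(\pi))$. -}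

module Defs where

open import Data.Bool using (Bool; true; false; if_then_else_)
open import Data.Nat as ℕ using (ℕ; zero; suc; _+_)
open import Data.Integer as ℤ using (ℤ; +_; -_; ∣_∣)
open import Data.List using (List; []; _∷_; map; concatMap; filter; length; upTo; last)
open import Data.Maybe using (Maybe; just)
import Data.Maybe.Properties as MaybeP
open import Relation.Nullary using (does; _×-dec_)
open import Relation.Binary.PropositionalEquality using (_≡_)
import Data.List.Relation.Unary.Unique.DecPropositional as UZ
import Data.List.Relation.Unary.Unique.DecPropositional as UN

words : {A : Set} → List A → ℕ → List (List A)
words X zero    = [] ∷ []
words X (suc n) = concatMap (λ x → map (x ∷_) (words X n)) X

desℕ : List ℕ → ℕ
desℕ []           = 0
desℕ (x ∷ [])     = 0
desℕ (x ∷ y ∷ ys) = (if does (y ℕ.<? x) then 1 else 0) + desℕ (y ∷ ys)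

desℤ : List ℤ → ℕ
desℤ []           = 0
desℤ (x ∷ [])     = 0
desℤ (x ∷ y ∷ ys) = (if does (y ℤ.<? x) then 1 else 0) + desℤ (y ∷ ys)

desB-signed : List ℤ → ℕ
desB-signed σ = desℤ (+ 0 ∷ σ)

-- Reduction: the entry whose absolute value is the k-th smallest is replaced by ±k
-- (sign preserved).  Rank of x = #{y in π : |y| ≤ |x|} (absolute values are distinct).
red : List ℤ → List ℤ
red π = map (λ x → signed x (length (filter (λ y → ∣ y ∣ ℕ.≤? ∣ x ∣) π))) π
  where
  signed : ℤ → ℕ → ℤ
  signed x k = if does (x ℤ.<? + 0) then - (+ k) else + k

desB : List ℤ → ℕ
desB π = desB-signed (red π)

[1…_] : ℕ → List ℕ
[1… n ] = map suc (upTo n)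

𝔖 : ℕ → ℕ → List (List ℕ)
𝔖 n m = filter (λ π → UN.unique? ℕ._≟_ π ×-dec MaybeP.≡-dec ℕ._≟_ (last π) (just m))
               (words [1… n ] n)

-- 𝐀_{n,m}(t) = Σ_{π ∈ 𝔖_{n,m}} t^{des π}, represented by its coefficient sequence:
-- 𝐀 n m k = coefficient of t^k.
𝐀 : ℕ → ℕ → ℕ → ℕ
𝐀 n m k = length (filter (λ π → desℕ π ℕ.≟ k) (𝔖 n m))

𝔗 : ℕ → List ℤ → ℕ → List (List ℤ)
𝔗 n X i = filter (λ π → UZ.unique? ℤ._≟_ π ×-dec MaybeP.≡-dec ℤ._≟_ (last π) (just (+ i)))
                 (words X n)

-- Coefficient of t^k in Σ_{π ∈ 𝔗_{n,X,i}} t^{des_B π}.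
𝔗poly : ℕ → List ℤ → ℕ → ℕ → ℕ
𝔗poly n X i k = length (filter (λ π → desB π ℕ.≟ k) (𝔗 n X i))

-- Write X = {ε(r)·r : r ∈ [n]} for a choice of signs ε with ε(i) = +, so that the words in 𝔗_{n,X}
-- are the words of letters ε(σₖ)·σₖ for the permutations σ of [n] ending with i. Reduction keeps the
-- signs and the relative order of the absolute values, so des_B π counts the descents of 0 π₁ ⋯ πₙ.
-- Rank [n] by the key that keeps the positive letters in place and puts the negative ones above n in
-- reverse order; the rank θ permutes [n], and σ ↦ θ ∘ σ is a bijection onto 𝔖_{n,θ(i)}. Adjacent
-- letters of equal sign are compared alike in ℤ and by the key, letters of opposite signs oppositely,
-- and the differences telescope to [π₁ < 0] − [πₙ < 0]: the first term is the descent at position 0,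
-- the second vanishes since πₙ = i, so des_B π = des (θ ∘ σ). Finally θ(i) counts the positive letters
-- up to i, which is i − j.

{-# OPTIONS --safe #-}
module Submission where

open import Defs
open import Data.Nat using (ℕ; _≤_; _<_; _∸_)
import Data.Nat as ℕ
open import Data.Integer using (ℤ; +_; -_; ∣_∣)
import Data.Integer as ℤ
open import Data.List using (List; length; filter)
open import Data.List.Membership.Propositional using (_∈_; _∉_)
open import Data.List.Relation.Unary.Unique.Propositional using (Unique)
open import Data.Product using (_×_)
open import Data.Sum using (_⊎_)
open import Relation.Nullary using (¬_; _×-dec_)
open import Relation.Binary.PropositionalEquality using (_≡_)

import Algebra.Properties.CommutativeSemigroup as CommutativeSemigroupₚ
open import Data.Bool using (Bool; true; false; if_then_else_; _∧_; T)
open import Data.Empty using (⊥-elim)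
open import Data.Integer using (-[1+_])
open import Data.List using ([]; _∷_; [_]; _++_; map; concatMap; upTo; last)
import Data.List.Properties as Listₚ
open import Data.List.Membership.DecPropositional ℤ._≟_ using (_∈?_)
open import Data.List.Membership.Propositional.Properties using (∈-∃++; ∈-++⁻; ∈-map⁺; ∈-map⁻; ∈-upTo⁺; ∈-upTo⁻)
open import Data.List.Membership.Propositional.Properties.WithK using (unique∧set⇒bag)
open import Data.List.Relation.Binary.BagAndSetEquality using (∼bag⇒↭; ↭⇒∼bag; >>=-cong)
open import Data.List.Relation.Binary.Permutation.Propositional as Perm using (_↭_; ↭-refl; ↭-prep; ↭-sym; ↭-trans)
open import Data.List.Relation.Binary.Permutation.Propositional.Properties using (shift; ↭-length; ∈-resp-↭; map⁺)
open import Data.List.Relation.Binary.Subset.Propositional using (_⊆_)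
open import Data.List.Relation.Unary.All as All using (All; []; _∷_)
import Data.List.Relation.Unary.All.Properties as Allₚ
open import Data.List.Relation.Unary.AllPairs using ([]; _∷_)
open import Data.List.Relation.Unary.Any using (here; there)
import Data.List.Relation.Unary.Unique.DecPropositional as UniqueDec
import Data.List.Relation.Unary.Unique.Propositional.Properties as Uniqueₚ
open import Data.Maybe as Maybe using (nothing; just)
import Data.Maybe.Properties as Maybeₚ
open import Data.Nat using (zero; suc; _+_; _⊓_; z≤n; s≤s)
import Data.Nat.Properties as ℕₚ
open import Data.Product using (_,_; proj₁; proj₂)
open import Data.Sum using (inj₁; inj₂)
open import Function using (_∘_)
open import Function.Bundles using (_⇔_; mk⇔)
open Function.Bundles.Equivalence using (to; from)
open import Relation.Binary.Definitions using (tri<; tri≈; tri>)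
open import Relation.Binary.PropositionalEquality using (refl; sym; trans; cong; cong₂; subst; _≢_; module ≡-Reasoning)
open import Relation.Nullary using (Dec; yes; no; does; contradiction)
open import Relation.Nullary.Decidable using (does-⇔; dec-true; dec-false)
open import Relation.Unary using (Pred; Decidable)

open CommutativeSemigroupₚ ℕₚ.+-commutativeSemigroup using (x∙yz≈y∙xz; x∙yz≈xz∙y; xy∙z≈xz∙y; interchange)

𝟙 : Bool → ℕ
𝟙 b = if b then 1 else 0

count : {A : Set} → (A → Bool) → List A → ℕ
count p []       = 0
count p (x ∷ xs) = 𝟙 (p x) + count p xs

module _ {A : Set} where

  length-filter≡count : ∀ {ℓ} {P : Pred A ℓ} (P? : Decidable P) xs →
    length (filter P? xs) ≡ count (does ∘ P?) xs
  length-filter≡count P? []       = refl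
  length-filter≡count P? (x ∷ xs) with does (P? x)
  ... | true  = cong suc (length-filter≡count P? xs)
  ... | false = length-filter≡count P? xs

  length-filter-filter : ∀ {ℓ ℓ′} {P : Pred A ℓ} {Q : Pred A ℓ′} (P? : Decidable P) (Q? : Decidable Q) xs →
    length (filter P? (filter Q? xs)) ≡ count (λ x → does (Q? x ×-dec P? x)) xs
  length-filter-filter P? Q? []       = refl
  length-filter-filter P? Q? (x ∷ xs) with does (Q? x)
  ... | false = length-filter-filter P? Q? xs
  ... | true with does (P? x)
  ...   | true  = cong suc (length-filter-filter P? Q? xs)
  ...   | false = length-filter-filter P? Q? xs

  count-++ : ∀ (p : A → Bool) xs ys → count p (xs ++ ys) ≡ count p xs + count p ys
  count-++ p []       ys = refl
  count-++ p (x ∷ xs) ys =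
    trans (cong (λ c → 𝟙 (p x) + c) (count-++ p xs ys)) (sym (ℕₚ.+-assoc (𝟙 (p x)) _ _))

  count-↭ : ∀ (p : A → Bool) {xs ys} → xs ↭ ys → count p xs ≡ count p ys
  count-↭ p Perm.refl          = refl
  count-↭ p (Perm.prep x q)    = cong (λ c → 𝟙 (p x) + c) (count-↭ p q)
  count-↭ p (Perm.swap x y q)  =
    trans (cong (λ c → 𝟙 (p x) + (𝟙 (p y) + c)) (count-↭ p q)) (x∙yz≈y∙xz (𝟙 (p x)) (𝟙 (p y)) _)
  count-↭ p (Perm.trans q q′)  = trans (count-↭ p q) (count-↭ p q′)

  count-map : ∀ {B : Set} (p : B → Bool) (f : A → B) xs → count p (map f xs) ≡ count (p ∘ f) xs
  count-map p f []       = refl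
  count-map p f (x ∷ xs) = cong (λ c → 𝟙 (p (f x)) + c) (count-map p f xs)

  count-cong-∈ : ∀ {p q : A → Bool} xs → (∀ {x} → x ∈ xs → p x ≡ q x) → count p xs ≡ count q xs
  count-cong-∈ []       _  = refl
  count-cong-∈ (x ∷ xs) eq = cong₂ _+_ (cong 𝟙 (eq (here refl))) (count-cong-∈ xs (eq ∘ there))

  count-+ : ∀ {p q r : A → Bool} xs → (∀ {x} → x ∈ xs → 𝟙 (p x) + 𝟙 (q x) ≡ 𝟙 (r x)) →
    count p xs + count q xs ≡ count r xs
  count-+ []       _  = refl
  count-+ {p} {q} (x ∷ xs) eq = trans (interchange (𝟙 (p x)) (count p xs) (𝟙 (q x)) (count q xs))
                                      (cong₂ _+_ (eq (here refl)) (count-+ xs (eq ∘ there)))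

  count-≤-length : ∀ (p : A → Bool) xs → count p xs ≤ length xs
  count-≤-length p []       = z≤n
  count-≤-length p (x ∷ xs) with p x
  ... | true  = s≤s (count-≤-length p xs)
  ... | false = ℕₚ.m≤n⇒m≤1+n (count-≤-length p xs)

  module _ {p q : A → Bool} (p⇒q : ∀ x → T (p x) → T (q x)) where

    count-mono : ∀ xs → count p xs ≤ count q xs
    count-mono []       = z≤n
    count-mono (x ∷ xs) with p x | q x | p⇒q x
    ... | true  | true  | _     = s≤s (count-mono xs)
    ... | true  | false | px⇒qx = ⊥-elim (px⇒qx _)
    ... | false | true  | _     = ℕₚ.m≤n⇒m≤1+n (count-mono xs)
    ... | false | false | _     = count-mono xs

    count-mono-< : ∀ {w} xs → w ∈ xs → ¬ T (p w) → T (q w) → count p xs < count q xs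
    count-mono-< (x ∷ xs) (here refl) ¬pw qw with p x | q x
    ... | true  | _     = ⊥-elim (¬pw _)
    ... | false | true  = s≤s (count-mono xs)
    count-mono-< (x ∷ xs) (there w∈) ¬pw qw with p x | q x | p⇒q x
    ... | true  | true  | _     = s≤s (count-mono-< xs w∈ ¬pw qw)
    ... | true  | false | px⇒qx = ⊥-elim (px⇒qx _)
    ... | false | true  | _     = ℕₚ.m≤n⇒m≤1+n (count-mono-< xs w∈ ¬pw qw)
    ... | false | false | _     = count-mono-< xs w∈ ¬pw qw

  count-pos : ∀ (p : A → Bool) {w} xs → w ∈ xs → T (p w) → 1 ≤ count p xs
  count-pos p (x ∷ xs) (here refl) px with p x
  ... | true  = s≤s z≤n
  ... | false = ⊥-elim px
  count-pos p (x ∷ xs) (there w∈) pw = ℕₚ.≤-trans (count-pos p xs w∈ pw) (ℕₚ.m≤n+m _ (𝟙 (p x)))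

InjectiveOn : {A B : Set} → (A → B) → List A → Set
InjectiveOn f xs = ∀ {x y} → x ∈ xs → y ∈ xs → f x ≡ f y → x ≡ y

module _ {A : Set} where

  Unique-map⁺-on : ∀ {B : Set} {f : A → B} {xs} → InjectiveOn f xs → Unique xs → Unique (map f xs)
  Unique-map⁺-on {xs = []}     _   []         = []
  Unique-map⁺-on {xs = x ∷ xs} inj (x∉ ∷ uxs) =
    Allₚ.map⁺ (All.tabulate (λ y∈ fx≡fy → All.lookup x∉ y∈ (inj (here refl) (there y∈) fx≡fy)))
    ∷ Unique-map⁺-on (λ x∈ y∈ → inj (there x∈) (there y∈)) uxs

  ⊆-length⇒↭ : ∀ {xs ys : List A} → Unique xs → xs ⊆ ys → length ys ≤ length xs → xs ↭ ys
  ⊆-length⇒↭ {[]} {[]} _ _ _ = ↭-refl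
  ⊆-length⇒↭ {x ∷ xs} (x∉ ∷ uxs) xs⊆ys |ys|≤ with ∈-∃++ (xs⊆ys (here refl))
  ... | as , bs , refl = ↭-trans (↭-prep x (⊆-length⇒↭ uxs xs⊆as++bs |as++bs|≤)) (↭-sym (shift x as bs))
    where
    xs⊆as++bs : xs ⊆ as ++ bs
    xs⊆as++bs z∈xs with ∈-resp-↭ (shift x as bs) (xs⊆ys (there z∈xs))
    ... | here refl = ⊥-elim (All.lookup x∉ z∈xs refl)
    ... | there z∈  = z∈
    |as++bs|≤ : length (as ++ bs) ≤ length xs
    |as++bs|≤ = ℕ.s≤s⁻¹ (subst (_≤ suc (length xs)) (↭-length (shift x as bs)) |ys|≤)

  last-∈ : ∀ {x : A} xs → last xs ≡ just x → x ∈ xs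
  last-∈ (x ∷ [])     refl = here refl
  last-∈ (_ ∷ y ∷ ys) eq   = there (last-∈ (y ∷ ys) eq)

  last-map-≡-just : ∀ {B : Set} (f : A → B) {l} xs → (∀ {x} → x ∈ xs → f x ≡ f l → x ≡ l) →
    last (map f xs) ≡ just (f l) ⇔ last xs ≡ just l
  last-map-≡-just f xs inj rewrite Listₚ.last-map f xs with last xs in eq
  ... | nothing = mk⇔ (λ ()) (λ ())
  ... | just x  = mk⇔ (λ e → cong just (inj (last-∈ xs eq) (Maybeₚ.just-injective e))) (cong (Maybe.map f))

∈-[1…]⁺ : ∀ {n r} → 1 ≤ r → r ≤ n → r ∈ [1… n ]
∈-[1…]⁺ {r = suc r} _ r≤n = ∈-map⁺ suc (∈-upTo⁺ r≤n)

∈-[1…]⁻ : ∀ {n r} → r ∈ [1… n ] → 1 ≤ r × r ≤ n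
∈-[1…]⁻ r∈ with ∈-map⁻ suc r∈
... | _ , r′∈ , refl = s≤s z≤n , ∈-upTo⁻ r′∈

Unique-[1…] : ∀ n → Unique [1… n ]
Unique-[1…] n = Uniqueₚ.map⁺ ℕₚ.suc-injective (Uniqueₚ.upTo⁺ n)

length-[1…] : ∀ n → length [1… n ] ≡ n
length-[1…] n = trans (Listₚ.length-map suc (upTo n)) (Listₚ.length-upTo n)

count-≤-[1…] : ∀ n i → count (λ r → does (r ℕ.≤? i)) [1… n ] ≡ n ⊓ i
count-≤-[1…] zero    i = refl
count-≤-[1…] (suc n) i = begin
  count p (map suc (upTo (suc n)))           ≡⟨ cong (count p ∘ map suc) (Listₚ.upTo-∷ʳ n) ⟨
  count p (map suc (upTo n ++ [ n ]))        ≡⟨ cong (count p) (Listₚ.map-++ suc (upTo n) [ n ]) ⟩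
  count p ([1… n ] ++ [ suc n ])             ≡⟨ count-++ p [1… n ] [ suc n ] ⟩
  count p [1… n ] + (𝟙 (p (suc n)) + 0)      ≡⟨ cong (_+ (𝟙 (p (suc n)) + 0)) (count-≤-[1…] n i) ⟩
  n ⊓ i + (𝟙 (p (suc n)) + 0)                ≡⟨ last-step (suc n ℕ.≤? i) ⟩
  suc n ⊓ i                                  ∎
  where
  open ≡-Reasoning
  p : ℕ → Bool
  p r = does (r ℕ.≤? i)
  last-step : (d : Dec (suc n ≤ i)) → n ⊓ i + (𝟙 (does d) + 0) ≡ suc n ⊓ i
  last-step (yes n<i) rewrite ℕₚ.m≤n⇒m⊓n≡m (ℕₚ.<⇒≤ n<i) | ℕₚ.m≤n⇒m⊓n≡m n<i = ℕₚ.+-comm n 1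
  last-step (no  n≮i) rewrite ℕₚ.m≥n⇒m⊓n≡n (ℕₚ.≮⇒≥ n≮i) | ℕₚ.m≥n⇒m⊓n≡n (ℕₚ.m≤n⇒m≤1+n (ℕₚ.≮⇒≥ n≮i)) =
    ℕₚ.+-identityʳ i

module _ {A : Set} where

  ∈-words⁻ : ∀ {Y : List A} n {σ} → σ ∈ words Y n → All (_∈ Y) σ
  ∈-words⁻ zero    (here refl) = []
  ∈-words⁻ {Y} (suc n) σ∈ = go Y (λ y∈ → y∈) σ∈
    where
    go : ∀ Z {σ} → Z ⊆ Y → σ ∈ concatMap (λ x → map (x ∷_) (words Y n)) Z → All (_∈ Y) σ
    go (z ∷ Z) Z⊆Y σ∈ with ∈-++⁻ (map (z ∷_) (words Y n)) σ∈
    ... | inj₁ σ∈z∷ with ∈-map⁻ (z ∷_) σ∈z∷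
    ...   | τ , τ∈ , refl = Z⊆Y (here refl) ∷ ∈-words⁻ n τ∈
    go (z ∷ Z) Z⊆Y σ∈ | inj₂ σ∈Z = go Z (Z⊆Y ∘ there) σ∈Z

  words-↭ : ∀ {Y Y′ : List A} n → Y ↭ Y′ → words Y n ↭ words Y′ n
  words-↭ zero    _    = ↭-refl
  words-↭ (suc n) Y↭Y′ = ∼bag⇒↭ (>>=-cong (↭⇒∼bag Y↭Y′) (λ x → ↭⇒∼bag (map⁺ (x ∷_) (words-↭ n Y↭Y′))))

  words-map : ∀ {B : Set} (f : A → B) Y n → words (map f Y) n ≡ map (map f) (words Y n)
  words-map f Y zero    = refl
  words-map f Y (suc n) = begin
    concatMap (λ y → map (y ∷_) (words (map f Y) n)) (map f Y)    ≡⟨ Listₚ.concatMap-map _ f Y ⟩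
    concatMap (λ x → map (f x ∷_) (words (map f Y) n)) Y          ≡⟨ Listₚ.concatMap-cong extend Y ⟩
    concatMap (λ x → map (map f) (map (x ∷_) (words Y n))) Y      ≡⟨ Listₚ.map-concatMap (map f) _ Y ⟨
    map (map f) (words Y (suc n))                                 ∎
    where
    open ≡-Reasoning
    extend : ∀ x → map (f x ∷_) (words (map f Y) n) ≡ map (map f) (map (x ∷_) (words Y n))
    extend x rewrite words-map f Y n = trans (sym (Listₚ.map-∘ (words Y n))) (Listₚ.map-∘ (words Y n))

count-words-relabel : ∀ {A B : Set} (p : List B → Bool) {Y : List B} {Z : List A} {f : A → B} n →
  Y ↭ map f Z → count p (words Y n) ≡ count (p ∘ map f) (words Z n)
count-words-relabel p {Y} {Z} {f} n Y↭fZ = begin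
  count p (words Y n)                   ≡⟨ count-↭ p (words-↭ n Y↭fZ) ⟩
  count p (words (map f Z) n)           ≡⟨ cong (count p) (words-map f Z n) ⟩
  count p (map (map f) (words Z n))     ≡⟨ count-map p (map f) (words Z n) ⟩
  count (p ∘ map f) (words Z n)         ∎
  where open ≡-Reasoning

rank : {A : Set} → (A → ℕ) → List A → A → ℕ
rank f xs x = count (λ y → f y ℕ.≤ᵇ f x) xs

module _ {A : Set} (f : A → ℕ) (xs : List A) where

  rank-pos : ∀ {x} → x ∈ xs → 1 ≤ rank f xs x
  rank-pos {x} x∈ = count-pos _ xs x∈ (ℕₚ.≤⇒≤ᵇ {f x} ℕₚ.≤-refl)

  rank-≤-length : ∀ x → rank f xs x ≤ length xs
  rank-≤-length x = count-≤-length _ xs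

  rank-mono-≤ : ∀ {x y} → f x ≤ f y → rank f xs x ≤ rank f xs y
  rank-mono-≤ {x} {y} fx≤fy =
    count-mono (λ z z≤x → ℕₚ.≤⇒≤ᵇ {f z} (ℕₚ.≤-trans (ℕₚ.≤ᵇ⇒≤ (f z) (f x) z≤x) fx≤fy)) xs

  rank-mono-< : ∀ {x y} → x ∈ xs → f y < f x → rank f xs y < rank f xs x
  rank-mono-< {x} {y} x∈ fy<fx =
    count-mono-< (λ z z≤y → ℕₚ.≤⇒≤ᵇ {f z} (ℕₚ.≤-trans (ℕₚ.≤ᵇ⇒≤ (f z) (f y) z≤y) (ℕₚ.<⇒≤ fy<fx))) xs x∈
      (λ x≤y → ℕₚ.<⇒≱ fy<fx (ℕₚ.≤ᵇ⇒≤ (f x) (f y) x≤y)) (ℕₚ.≤⇒≤ᵇ {f x} ℕₚ.≤-refl)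

  does-rank-< : ∀ {x y} → x ∈ xs → does (rank f xs y ℕ.<? rank f xs x) ≡ does (f y ℕ.<? f x)
  does-rank-< {x} {y} x∈ =
    does-⇔ (mk⇔ (λ ry<rx → ℕₚ.≰⇒> (ℕₚ.<⇒≱ ry<rx ∘ rank-mono-≤ {x} {y})) (rank-mono-< x∈))
           (rank f xs y ℕ.<? rank f xs x) (f y ℕ.<? f x)

  rank-injective : InjectiveOn f xs → InjectiveOn (rank f xs) xs
  rank-injective inj {x} {y} x∈ y∈ rx≡ry with ℕₚ.<-cmp (f x) (f y)
  ... | tri< fx<fy _ _ = ⊥-elim (ℕₚ.<-irrefl rx≡ry (rank-mono-< y∈ fx<fy))
  ... | tri≈ _ fx≡fy _ = inj x∈ y∈ fx≡fy
  ... | tri> _ _ fy<fx = ⊥-elim (ℕₚ.<-irrefl (sym rx≡ry) (rank-mono-< x∈ fy<fx))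

  map-rank-↭ : Unique xs → InjectiveOn f xs → map (rank f xs) xs ↭ [1… length xs ]
  map-rank-↭ uxs inj = ⊆-length⇒↭ (Unique-map⁺-on (rank-injective inj) uxs) ranks⊆
    (ℕₚ.≤-reflexive (trans (length-[1…] (length xs)) (sym (Listₚ.length-map (rank f xs) xs))))
    where
    ranks⊆ : map (rank f xs) xs ⊆ [1… length xs ]
    ranks⊆ r∈ with ∈-map⁻ (rank f xs) r∈
    ... | x , x∈ , refl = ∈-[1…]⁺ (rank-pos x∈) (rank-≤-length x)

desℕ-map-cong : ∀ {A : Set} {f g : A → ℕ} σ →
  (∀ {x y} → x ∈ σ → y ∈ σ → does (f y ℕ.<? f x) ≡ does (g y ℕ.<? g x)) →
  desℕ (map f σ) ≡ desℕ (map g σ)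
desℕ-map-cong []           _    = refl
desℕ-map-cong (_ ∷ [])     _    = refl
desℕ-map-cong (x ∷ y ∷ ys) same =
  cong₂ _+_ (cong 𝟙 (same (here refl) (there (here refl))))
            (desℕ-map-cong (y ∷ ys) (λ x∈ y∈ → same (there x∈) (there y∈)))

desℤ-map-cong : ∀ {A : Set} {f g : A → ℤ} σ →
  (∀ {x y} → x ∈ σ → y ∈ σ → does (f y ℤ.<? f x) ≡ does (g y ℤ.<? g x)) →
  desℤ (map f σ) ≡ desℤ (map g σ)
desℤ-map-cong []           _    = refl
desℤ-map-cong (_ ∷ [])     _    = refl
desℤ-map-cong (x ∷ y ∷ ys) same =
  cong₂ _+_ (cong 𝟙 (same (here refl) (there (here refl))))
            (desℤ-map-cong (y ∷ ys) (λ x∈ y∈ → same (there x∈) (there y∈)))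

desℕ-desℤ-telescope : ∀ {A : Set} (f : A → ℕ) (g : A → ℤ) (c : A → ℕ) {h l} t →
  (∀ {x y} → x ∈ h ∷ t → y ∈ h ∷ t → 𝟙 (does (f y ℕ.<? f x)) + c y ≡ 𝟙 (does (g y ℤ.<? g x)) + c x) →
  last (h ∷ t) ≡ just l → desℕ (map f (h ∷ t)) + c l ≡ desℤ (map g (h ∷ t)) + c h
desℕ-desℤ-telescope f g c []      _    refl = refl
desℕ-desℤ-telescope f g c {h} {l} (y ∷ t) exch last≡l = begin
  (dᶠ + Dᶠ) + c l    ≡⟨ ℕₚ.+-assoc dᶠ Dᶠ (c l) ⟩
  dᶠ + (Dᶠ + c l)    ≡⟨ cong (_+_ dᶠ) (desℕ-desℤ-telescope f g c t (λ x∈ y∈ → exch (there x∈) (there y∈)) last≡l) ⟩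
  dᶠ + (Dᵍ + c y)    ≡⟨ x∙yz≈xz∙y dᶠ Dᵍ (c y) ⟩
  (dᶠ + c y) + Dᵍ    ≡⟨ cong (_+ Dᵍ) (exch (here refl) (there (here refl))) ⟩
  (dᵍ + c h) + Dᵍ    ≡⟨ xy∙z≈xz∙y dᵍ (c h) Dᵍ ⟩
  (dᵍ + Dᵍ) + c h    ∎
  where
  open ≡-Reasoning
  dᶠ dᵍ Dᶠ Dᵍ : ℕ
  dᶠ = 𝟙 (does (f y ℕ.<? f h))
  dᵍ = 𝟙 (does (g y ℤ.<? g h))
  Dᶠ = desℕ (map f (y ∷ t))
  Dᵍ = desℤ (map g (y ∷ t))

signed : Bool → ℕ → ℤ
signed b k = if b then - (+ k) else + k

does-signed-<0 : ∀ b {k} → 1 ≤ k → does (signed b k ℤ.<? + 0) ≡ b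
does-signed-<0 true  (s≤s z≤n) = refl
does-signed-<0 false (s≤s z≤n) = refl

signed-sign-∣∣ : ∀ x → signed (does (x ℤ.<? + 0)) ∣ x ∣ ≡ x
signed-sign-∣∣ (+ _)    = refl
signed-sign-∣∣ -[1+ _ ] = refl

∣signed∣ : ∀ b k → ∣ signed b k ∣ ≡ k
∣signed∣ true  zero    = refl
∣signed∣ true  (suc _) = refl
∣signed∣ false _       = refl

does-signed-<-cong : ∀ b c {k l k′ l′} → 1 ≤ k → 1 ≤ l → 1 ≤ k′ → 1 ≤ l′ →
  does (k ℕ.<? l) ≡ does (k′ ℕ.<? l′) → does (l ℕ.<? k) ≡ does (l′ ℕ.<? k′) →
  does (signed b k ℤ.<? signed c l) ≡ does (signed b k′ ℤ.<? signed c l′)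
does-signed-<-cong false false _         _         _         _         k<l _   = k<l
does-signed-<-cong true  true  (s≤s z≤n) (s≤s z≤n) (s≤s z≤n) (s≤s z≤n) _   l<k = l<k
does-signed-<-cong true  false (s≤s z≤n) _         (s≤s z≤n) _         _   _   = refl
does-signed-<-cong false true  _         (s≤s z≤n) _         (s≤s z≤n) _   _   = refl

desB-signed-cong : ∀ {A : Set} (b : A → Bool) (k l : A → ℕ) σ →
  (∀ {x} → x ∈ σ → 1 ≤ k x) → (∀ {x} → x ∈ σ → 1 ≤ l x) →
  (∀ {x y} → x ∈ σ → y ∈ σ → does (k y ℕ.<? k x) ≡ does (l y ℕ.<? l x)) →
  desB-signed (map (λ x → signed (b x) (k x)) σ) ≡ desB-signed (map (λ x → signed (b x) (l x)) σ)
desB-signed-cong b k l []      _     _     _    = refl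
desB-signed-cong b k l (h ∷ t) k-pos l-pos same = cong₂ _+_
  (cong 𝟙 (trans (does-signed-<0 (b h) (k-pos (here refl))) (sym (does-signed-<0 (b h) (l-pos (here refl))))))
  (desℤ-map-cong (h ∷ t) (λ x∈ y∈ →
    does-signed-<-cong (b _) (b _) (k-pos y∈) (k-pos x∈) (l-pos y∈) (l-pos x∈) (same x∈ y∈) (same y∈ x∈)))

≢0⇒1≤∣∣ : ∀ {x} → x ≢ + 0 → 1 ≤ ∣ x ∣
≢0⇒1≤∣∣ {+ zero}   x≢0 = ⊥-elim (x≢0 refl)
≢0⇒1≤∣∣ {+ suc _}  _   = s≤s z≤n
≢0⇒1≤∣∣ { -[1+ _ ]} _  = s≤s z≤n

desB≡desB-signed : ∀ π → All (_≢ + 0) π → desB π ≡ desB-signed π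
desB≡desB-signed π π≢0 = begin
  desB-signed (red π)
    ≡⟨ cong desB-signed (Listₚ.map-cong (λ x → cong (signed (isNeg x)) (length-filter≡count _ π)) π) ⟩
  desB-signed (map (λ x → signed (isNeg x) (rank ∣_∣ π x)) π)
    ≡⟨ desB-signed-cong isNeg (rank ∣_∣ π) ∣_∣ π (rank-pos ∣_∣ π) (≢0⇒1≤∣∣ ∘ All.lookup π≢0)
         (λ {_} {y} x∈ _ → does-rank-< ∣_∣ π {y = y} x∈) ⟩
  desB-signed (map (λ x → signed (isNeg x) ∣ x ∣) π)
    ≡⟨ cong desB-signed (trans (Listₚ.map-cong signed-sign-∣∣ π) (Listₚ.map-id π)) ⟩
  desB-signed π ∎
  where
  open ≡-Reasoning
  isNeg : ℤ → Bool
  isNeg x = does (x ℤ.<? + 0)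

module Signing (n : ℕ) (ε : ℕ → Bool) where

  letter : ℕ → ℤ
  letter r = signed (ε r) r

  key : ℕ → ℕ
  key r = if ε r then n + (suc n ∸ r) else r

  θ : ℕ → ℕ
  θ = rank key [1… n ]

  letter-injective : ∀ {x y} → letter x ≡ letter y → x ≡ y
  letter-injective {x} {y} eq = trans (sym (∣signed∣ (ε x) x)) (trans (cong ∣_∣ eq) (∣signed∣ (ε y) y))

  letter≢0 : ∀ {r} → r ∈ [1… n ] → letter r ≢ + 0
  letter≢0 {r} r∈ eq = ℕₚ.<⇒≢ (proj₁ (∈-[1…]⁻ r∈)) (trans (sym (cong ∣_∣ eq)) (∣signed∣ (ε r) r))

  private
    n<flip : ∀ {r} → r ≤ n → n < n + (suc n ∸ r)
    n<flip r≤n = ℕₚ.m<m+n n (ℕₚ.m<n⇒0<n∸m (s≤s r≤n))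

    does-flip-< : ∀ {x y} → x ≤ n → y ≤ n → does (n + (suc n ∸ y) ℕ.<? n + (suc n ∸ x)) ≡ does (x ℕ.<? y)
    does-flip-< {x} {y} x≤n y≤n = does-⇔
      (mk⇔ (ℕₚ.∸-cancelʳ-< ∘ ℕₚ.+-cancelˡ-< n _ _)
           (λ x<y → ℕₚ.+-monoʳ-< n (ℕₚ.∸-monoʳ-< x<y (ℕₚ.m≤n⇒m≤1+n y≤n))))
      (n + (suc n ∸ y) ℕ.<? n + (suc n ∸ x)) (x ℕ.<? y)

  key-injective : InjectiveOn key [1… n ]
  key-injective {x} {y} x∈ y∈ eq with ε x | ε y | ∈-[1…]⁻ x∈ | ∈-[1…]⁻ y∈
  ... | false | false | _       | _       = eq
  ... | true  | true  | _ , x≤n | _ , y≤n =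
    ℕₚ.∸-cancelˡ-≡ (ℕₚ.m≤n⇒m≤1+n x≤n) (ℕₚ.m≤n⇒m≤1+n y≤n) (ℕₚ.+-cancelˡ-≡ n _ _ eq)
  ... | true  | false | _ , x≤n | _ , y≤n = ⊥-elim (ℕₚ.<⇒≱ (n<flip x≤n) (subst (_≤ n) (sym eq) y≤n))
  ... | false | true  | _ , x≤n | _ , y≤n = ⊥-elim (ℕₚ.<⇒≱ (n<flip y≤n) (subst (_≤ n) eq x≤n))

  θ-injective : InjectiveOn θ [1… n ]
  θ-injective = rank-injective key [1… n ] key-injective

  θ-↭ : map θ [1… n ] ↭ [1… n ]
  θ-↭ = subst (λ m → map θ [1… n ] ↭ [1… m ]) (length-[1…] n)
    (map-rank-↭ key [1… n ] (Unique-[1…] n) key-injective)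

  descent-exchange : ∀ {x y} → x ∈ [1… n ] → y ∈ [1… n ] →
    𝟙 (does (key y ℕ.<? key x)) + 𝟙 (ε y) ≡ 𝟙 (does (letter y ℤ.<? letter x)) + 𝟙 (ε x)
  descent-exchange {x} {y} x∈ y∈ with ε x | ε y | ∈-[1…]⁻ x∈ | ∈-[1…]⁻ y∈
  ... | false | false | _               | _               = refl
  ... | true  | true  | s≤s z≤n , x≤n   | s≤s z≤n , y≤n   = cong (λ b → 𝟙 b + 1) (does-flip-< x≤n y≤n)
  ... | false | true  | _ , x≤n         | s≤s z≤n , y≤n   =
    cong (λ b → 𝟙 b + 1)
         (dec-false (_ ℕ.<? x) (λ flip<x → ℕₚ.<⇒≱ (n<flip y≤n) (ℕₚ.≤-trans (ℕₚ.<⇒≤ flip<x) x≤n)))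
  ... | true  | false | s≤s z≤n , x≤n   | _ , y≤n         =
    cong (λ b → 𝟙 b + 0) (dec-true (y ℕ.<? _) (ℕₚ.≤-<-trans y≤n (n<flip x≤n)))

  desB-map-letter : ∀ {σ l} → All (_∈ [1… n ]) σ → last σ ≡ just l →
    desB (map letter σ) ≡ desℕ (map θ σ) + 𝟙 (ε l)
  desB-map-letter {h ∷ t} {l} σ⊆ last≡l = begin
    desB (map letter (h ∷ t))
      ≡⟨ desB≡desB-signed (map letter (h ∷ t)) (Allₚ.map⁺ (All.map letter≢0 σ⊆)) ⟩
    𝟙 (does (letter h ℤ.<? + 0)) + desℤ (map letter (h ∷ t))
      ≡⟨ cong (λ b → 𝟙 b + desℤ (map letter (h ∷ t)))
              (does-signed-<0 (ε h) (proj₁ (∈-[1…]⁻ (All.lookup σ⊆ (here refl))))) ⟩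
    𝟙 (ε h) + desℤ (map letter (h ∷ t))
      ≡⟨ ℕₚ.+-comm (𝟙 (ε h)) _ ⟩
    desℤ (map letter (h ∷ t)) + 𝟙 (ε h)
      ≡⟨ desℕ-desℤ-telescope key letter (𝟙 ∘ ε) t
           (λ x∈ y∈ → descent-exchange (All.lookup σ⊆ x∈) (All.lookup σ⊆ y∈)) last≡l ⟨
    desℕ (map key (h ∷ t)) + 𝟙 (ε l)
      ≡⟨ cong (_+ 𝟙 (ε l))
              (desℕ-map-cong (h ∷ t) (λ {_} {y} x∈ _ → does-rank-< key [1… n ] {y = y} (All.lookup σ⊆ x∈))) ⟨
    desℕ (map θ (h ∷ t)) + 𝟙 (ε l) ∎
    where open ≡-Reasoning

  θ-positive-letter : ∀ {i} → i ∈ [1… n ] → ε i ≡ false →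
    θ i ≡ i ∸ count (λ r → ε r ∧ does (r ℕ.<? i)) [1… n ]
  θ-positive-letter {i} i∈ εi≡false = begin
    θ i                                          ≡⟨ ℕₚ.m+n∸n≡m (θ i) (count negative-below [1… n ]) ⟨
    θ i + count negative-below [1… n ] ∸ count negative-below [1… n ]
                                                 ≡⟨ cong (_∸ count negative-below [1… n ]) θ+negatives≡i ⟩
    i ∸ count negative-below [1… n ]             ∎
    where
    open ≡-Reasoning
    negative-below : ℕ → Bool
    negative-below r = ε r ∧ does (r ℕ.<? i)
    split : ∀ {r} → r ∈ [1… n ] → 𝟙 (key r ℕ.≤ᵇ key i) + 𝟙 (negative-below r) ≡ 𝟙 (does (r ℕ.≤? i))
    split {r} r∈ rewrite εi≡false with ε r in εr
    ... | false = ℕₚ.+-identityʳ _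
    ... | true  = trans (cong (λ b → 𝟙 b + _) flip≰i)
                        (cong 𝟙 (does-⇔ (mk⇔ ℕₚ.<⇒≤ r≤i⇒r<i) (r ℕ.<? i) (r ℕ.≤? i)))
      where
      flip≰i : does (n + (suc n ∸ r) ℕ.≤? i) ≡ false
      flip≰i = dec-false (_ ℕ.≤? i)
        (λ flip≤i → ℕₚ.<⇒≱ (n<flip (proj₂ (∈-[1…]⁻ r∈))) (ℕₚ.≤-trans flip≤i (proj₂ (∈-[1…]⁻ i∈))))
      r≤i⇒r<i : r ≤ i → r < i
      r≤i⇒r<i r≤i = ℕₚ.≤∧≢⇒< r≤i (λ r≡i → contradiction (trans (sym εr) (trans (cong ε r≡i) εi≡false)) λ ())
    θ+negatives≡i : θ i + count negative-below [1… n ] ≡ i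
    θ+negatives≡i = begin
      θ i + count negative-below [1… n ]   ≡⟨ count-+ [1… n ] split ⟩
      count (λ r → does (r ℕ.≤? i)) [1… n ] ≡⟨ count-≤-[1…] n i ⟩
      n ⊓ i                                ≡⟨ ℕₚ.m≥n⇒m⊓n≡n (proj₂ (∈-[1…]⁻ i∈)) ⟩
      i                                    ∎

  𝔗-conditions⇔𝔖-conditions : ∀ {i m k σ} → i ∈ [1… n ] → ε i ≡ false → θ i ≡ m → All (_∈ [1… n ]) σ →
    ((Unique (map letter σ) × last (map letter σ) ≡ just (+ i)) × desB (map letter σ) ≡ k)
    ⇔ ((Unique (map θ σ) × last (map θ σ) ≡ just m) × desℕ (map θ σ) ≡ k)
  𝔗-conditions⇔𝔖-conditions {i} {σ = σ} i∈ εi≡false refl σ⊆ = mk⇔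
    (λ ((u , l) , d) → (Unique-map⁺-on θ-on-σ (Uniqueₚ.map⁻ u) , from θ-last (to letter-last l))
                     , trans (sym (des≡ (to letter-last l))) d)
    (λ ((u , l) , d) → (Uniqueₚ.map⁺ letter-injective (Uniqueₚ.map⁻ u) , from letter-last (to θ-last l))
                     , trans (des≡ (to θ-last l)) d)
    where
    θ-on-σ : InjectiveOn θ σ
    θ-on-σ x∈ y∈ = θ-injective (All.lookup σ⊆ x∈) (All.lookup σ⊆ y∈)
    letter-last : last (map letter σ) ≡ just (+ i) ⇔ last σ ≡ just i
    letter-last = subst (λ z → last (map letter σ) ≡ just z ⇔ last σ ≡ just i) (cong (λ b → signed b i) εi≡false)
      (last-map-≡-just letter σ (λ _ → letter-injective))
    θ-last : last (map θ σ) ≡ just (θ i) ⇔ last σ ≡ just i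
    θ-last = last-map-≡-just θ σ (λ x∈ → θ-injective (All.lookup σ⊆ x∈) i∈)
    des≡ : last σ ≡ just i → desB (map letter σ) ≡ desℕ (map θ σ)
    des≡ last≡i = trans (desB-map-letter σ⊆ last≡i)
                        (trans (cong (λ b → desℕ (map θ σ) + 𝟙 b) εi≡false) (ℕₚ.+-identityʳ _))

module SignedSubset (n : ℕ) (X : List ℤ) (uX : Unique X) (bounded : ∀ {x} → x ∈ X → x ≢ + 0 × ∣ x ∣ ≤ n)
  (one-sign : ∀ r → 1 ≤ r → r ≤ n → (+ r ∈ X × - (+ r) ∉ X) ⊎ (- (+ r) ∈ X × + r ∉ X)) where

  ε : ℕ → Bool
  ε r = does (- (+ r) ∈? X)

  open Signing n ε public

  letter∈X : ∀ {r} → r ∈ [1… n ] → letter r ∈ X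
  letter∈X {r} r∈ with - (+ r) ∈? X | one-sign r (proj₁ (∈-[1…]⁻ r∈)) (proj₂ (∈-[1…]⁻ r∈))
  ... | yes -r∈X | _               = -r∈X
  ... | no  _    | inj₁ (r∈X , _)  = r∈X
  ... | no  -r∉X | inj₂ (-r∈X , _) = ⊥-elim (-r∉X -r∈X)

  letter-∣∣ : ∀ {x} → x ∈ X → letter ∣ x ∣ ≡ x
  letter-∣∣ {+ zero}   x∈X = ⊥-elim (proj₁ (bounded x∈X) refl)
  letter-∣∣ {+ suc r}  x∈X with - (+ suc r) ∈? X | one-sign (suc r) (s≤s z≤n) (proj₂ (bounded x∈X))
  ... | no  _    | _               = refl
  ... | yes -r∈X | inj₁ (_ , -r∉X) = ⊥-elim (-r∉X -r∈X)
  ... | yes _    | inj₂ (_ , r∉X)  = ⊥-elim (r∉X x∈X)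
  letter-∣∣ { -[1+ r ]} x∈X with - (+ suc r) ∈? X
  ... | yes _    = refl
  ... | no  -r∉X = ⊥-elim (-r∉X x∈X)

  X↭letters : X ↭ map letter [1… n ]
  X↭letters =
    ∼bag⇒↭ (unique∧set⇒bag uX (Uniqueₚ.map⁺ letter-injective (Unique-[1…] n)) (mk⇔ X⊆letters letters⊆X))
    where
    X⊆letters : X ⊆ map letter [1… n ]
    X⊆letters x∈X = subst (_∈ map letter [1… n ]) (letter-∣∣ x∈X)
      (∈-map⁺ letter (∈-[1…]⁺ (≢0⇒1≤∣∣ (proj₁ (bounded x∈X))) (proj₂ (bounded x∈X))))
    letters⊆X : map letter [1… n ] ⊆ X
    letters⊆X y∈ with ∈-map⁻ letter y∈
    ... | r , r∈ , refl = letter∈X r∈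

  ε-positive : ∀ {r} → - (+ r) ∉ X → ε r ≡ false
  ε-positive {r} = dec-false (- (+ r) ∈? X)

  negatives-below : ∀ i → length (filter (λ x → (x ℤ.<? + 0) ×-dec (∣ x ∣ ℕ.<? i)) X)
                          ≡ count (λ r → ε r ∧ does (r ℕ.<? i)) [1… n ]
  negatives-below i = begin
    length (filter F? X)                   ≡⟨ length-filter≡count F? X ⟩
    count (does ∘ F?) X                    ≡⟨ count-↭ (does ∘ F?) X↭letters ⟩
    count (does ∘ F?) (map letter [1… n ]) ≡⟨ count-map (does ∘ F?) letter [1… n ] ⟩
    count (does ∘ F? ∘ letter) [1… n ]     ≡⟨ count-cong-∈ [1… n ] negative-letter ⟩
    count (λ r → ε r ∧ does (r ℕ.<? i)) [1… n ] ∎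
    where
    open ≡-Reasoning
    F? : (x : ℤ) → Dec ((x ℤ.< + 0) × (∣ x ∣ < i))
    F? x = (x ℤ.<? + 0) ×-dec (∣ x ∣ ℕ.<? i)
    negative-letter : ∀ {r} → r ∈ [1… n ] → does (F? (letter r)) ≡ ε r ∧ does (r ℕ.<? i)
    negative-letter {r} r∈ = cong₂ _∧_ (does-signed-<0 (ε r) (proj₁ (∈-[1…]⁻ r∈)))
                                       (cong (λ m → does (m ℕ.<? i)) (∣signed∣ (ε r) r))

lemma2p3 : (n i j : ℕ) → 1 ≤ i → i ≤ n → j < i →
    (X : List ℤ) → Unique X →
    (∀ x → x ∈ X → ¬ x ≡ + 0 × ∣ x ∣ ≤ n × ¬ x ≡ - (+ i)) →
    (∀ r → 1 ≤ r → r ≤ n → (+ r ∈ X × - (+ r) ∉ X) ⊎ (- (+ r) ∈ X × + r ∉ X)) →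
    length (filter (λ x → (x ℤ.<? + 0) ×-dec (∣ x ∣ ℕ.<? i)) X) ≡ j →
    ∀ k → 𝔗poly n X i k ≡ 𝐀 n (i ∸ j) k
-- The hypothesis j < i is unused: j counts letters of distinct absolute values below i, so it holds anyway.
lemma2p3 n i j 1≤i i≤n _ X uX h3 h4 hj k = begin
  𝔗poly n X i k                                      ≡⟨ length-filter-filter _ _ (words X n) ⟩
  count (does ∘ T?) (words X n)                      ≡⟨ count-words-relabel (does ∘ T?) n X↭letters ⟩
  count (does ∘ T? ∘ map letter) (words [1… n ] n)   ≡⟨ count-cong-∈ (words [1… n ] n) transfer ⟩
  count (does ∘ S? ∘ map θ) (words [1… n ] n)        ≡⟨ count-words-relabel (does ∘ S?) n (↭-sym θ-↭) ⟨
  count (does ∘ S?) (words [1… n ] n)                ≡⟨ length-filter-filter _ _ (words [1… n ] n) ⟨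
  𝐀 n (i ∸ j) k                                      ∎
  where
  open ≡-Reasoning
  open SignedSubset n X uX (λ x∈X → proj₁ (h3 _ x∈X) , proj₁ (proj₂ (h3 _ x∈X))) h4
  T? : (π : List ℤ) → Dec ((Unique π × last π ≡ just (+ i)) × desB π ≡ k)
  T? π = (UniqueDec.unique? ℤ._≟_ π ×-dec Maybeₚ.≡-dec ℤ._≟_ (last π) (just (+ i))) ×-dec desB π ℕ.≟ k
  S? : (π : List ℕ) → Dec ((Unique π × last π ≡ just (i ∸ j)) × desℕ π ≡ k)
  S? π = (UniqueDec.unique? ℕ._≟_ π ×-dec Maybeₚ.≡-dec ℕ._≟_ (last π) (just (i ∸ j))) ×-dec desℕ π ℕ.≟ k
  i∈[1…n] : i ∈ [1… n ]
  i∈[1…n] = ∈-[1…]⁺ 1≤i i≤n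
  εi≡false : ε i ≡ false
  εi≡false = ε-positive (λ -i∈X → proj₂ (proj₂ (h3 _ -i∈X)) refl)
  θi≡i∸j : θ i ≡ i ∸ j
  θi≡i∸j = trans (θ-positive-letter i∈[1…n] εi≡false) (cong (i ∸_) (trans (sym (negatives-below i)) hj))
  transfer : ∀ {σ} → σ ∈ words [1… n ] n → does (T? (map letter σ)) ≡ does (S? (map θ σ))
  transfer {σ} σ∈ = does-⇔
    (𝔗-conditions⇔𝔖-conditions i∈[1…n] εi≡false θi≡i∸j (∈-words⁻ n σ∈))
    (T? (map letter σ)) (S? (map θ σ))
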